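{- Let $s\ge 9$ and $d>2$ be integers, and let $C_s^c$ denote the complement of the cycle $C_s$ of length $s$. Then $C_s^c$ is not the intersection graph of any family of $2$-boxes in $\mathbb{R}^d$.
   Context: A $2$-box in $\mathbb{R}^d$ is a rectangular $2$-dimensional parallelotope with edges parallel to the coordinate axes, i.e. a product of $d$ compact intervals exactly two of which are nondegenerate. The intersection graph of a finite family $\{X_1,\dots,X_k\}$ of sets has vertices $x_1,\dots,x_k$, with $x_ix_j$ an edge ($i\neq j$) iff $X_i\cap X_j\ne\emptyset$. -}

module Defs where

open import Level using (Level; _⊔_)
open import Data.Nat using (ℕ; suc; _∸_)
open import Data.Fin using (Fin; toℕ)
open import Data.Product using (Σ; ∃; _×_)
open import Data.Sum using (_⊎_)
open import Relation.Nullary using (¬_)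
open import Relation.Binary.PropositionalEquality using (_≡_; _≢_)
open import Relation.Binary.Bundles using (TotalOrder)
open import Function.Bundles using (_⇔_)

-- Coordinates range over an arbitrary total order O (the real line ℝ with
-- its usual order is one instance).  A point of "O^d" is a function Fin d → O.
module _ {a ℓ₁ ℓ₂ : Level} (O : TotalOrder a ℓ₁ ℓ₂) where
  open TotalOrder O renaming (Carrier to A)

  record Box (d : ℕ) : Set (a ⊔ ℓ₂) where
    field
      lo hi : Fin d → A
      lo≤hi : ∀ k → lo k ≤ hi k

  open Box public

  Nondeg : ∀ {d} → Box d → Fin d → Set ℓ₁
  Nondeg B k = ¬ (lo B k ≈ hi B k)

  Is2Box : ∀ {d} → Box d → Set ℓ₁
  Is2Box {d} B = Σ (Fin d) λ i → Σ (Fin d) λ j →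
    i ≢ j × Nondeg B i × Nondeg B j ×
    (∀ k → k ≢ i → k ≢ j → lo B k ≈ hi B k)

  _∈Box_ : ∀ {d} → (Fin d → A) → Box d → Set ℓ₂
  x ∈Box B = ∀ k → (lo B k ≤ x k) × (x k ≤ hi B k)

  Meets : ∀ {d} → Box d → Box d → Set (a ⊔ ℓ₂)
  Meets {d} B C = ∃ λ (x : Fin d → A) → x ∈Box B × x ∈Box C

  IsIntersectionGraphOf : ∀ {n d} {ℓ : Level} →
    (Fin n → Fin n → Set ℓ) → (Fin n → Box d) → Set (a ⊔ ℓ ⊔ ℓ₂)
  IsIntersectionGraphOf {n} Adj X =
    ∀ (i j : Fin n) → i ≢ j → Adj i j ⇔ Meets (X i) (X j)

-- Cycle C_s on vertex set Fin s = {0,…,s-1}: i ~ j iff j ≡ i+1 (mod s)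
-- or i ≡ j+1 (mod s), written without mod: consecutive, or {s-1, 0}.
SuccMod : (s : ℕ) → Fin s → Fin s → Set
SuccMod s i j = (toℕ j ≡ suc (toℕ i)) ⊎ ((toℕ i ≡ s ∸ 1) × (toℕ j ≡ 0))

CycleAdj : (s : ℕ) → Fin s → Fin s → Set
CycleAdj s i j = SuccMod s i j ⊎ SuccMod s j i

CycleComplAdj : (s : ℕ) → Fin s → Fin s → Set
CycleComplAdj s i j = i ≢ j × ¬ CycleAdj s i j

module Submission where

-- Two boxes meet iff their projections overlap in every coordinate, so two
-- disjoint boxes are separated in some coordinate k (constructively: it is
-- not the case that no such k exists).  Two interval facts drive the proof:
--   (1) if a 2-box X meets both of two boxes separated in coordinate k, then
--       k is one of the two nondegenerate directions of X (otherwise the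
--       projection of X to k is a point lying in both projections);
--   (2) two pairs of boxes separated in the same coordinate k cannot all
--       meet each other crosswise.
-- Restrict a realisation of C_s^c to the vertices 0,…,8.  Consecutive
-- vertices i, i+1 give disjoint boxes, separated in a coordinate k i.  By
-- (1) the two directions of the boxes 0, 1 and 8 contain several of the
-- k i, and by (2) k i ≢ k j whenever j ≥ i + 3.  A two-element
-- pigeonhole argument then forces k 1 ≡ k 5, contradicting (2).

open import Defs
open import Level using (Level)
open import Data.Nat using (ℕ; _≤_; _<_)
open import Data.Fin using (Fin)
open import Data.Product using (Σ; _×_)
open import Relation.Nullary using (¬_)
open import Relation.Binary.Bundles using (TotalOrder)

open import Data.Nat using (suc; _∸_; s≤s⁻¹; _≟_)
import Data.Nat.Properties as ℕₚ
open import Data.Fin using (zero; suc; toℕ; inject₁; inject≤; #_)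
import Data.Fin.Properties as Finₚ
open import Data.Product using (_,_; proj₁; proj₂)
open import Data.Sum using (_⊎_; inj₁; inj₂)
open import Data.Empty using (⊥; ⊥-elim)
open import Function using (_∘_)
open import Function.Bundles using (Equivalence)
open import Relation.Nullary using (Dec; yes; no)
open import Relation.Nullary.Decidable using (True; toWitness; ¬?; _×-dec_; _⊎-dec_)
open import Relation.Binary.PropositionalEquality
  using (_≡_; _≢_; sym; trans; cong; subst; module ≡-Reasoning)

-- Finite double-negation shift: pointwise ¬¬ over Fin n can be pulled out.
-- It turns "each disjoint pair is ¬¬-separated" into one ¬¬ statement.
¬¬-shiftFin : ∀ {ℓ n} {P : Fin n → Set ℓ} → (∀ i → ¬ ¬ P i) → ¬ ¬ (∀ i → P i)
¬¬-shiftFin {n = 0} _ ¬all = ¬all (λ ())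
¬¬-shiftFin {n = suc n} {P} ¬¬P ¬all =
  ¬¬P zero λ p₀ → ¬¬-shiftFin {P = P ∘ suc} (¬¬P ∘ suc) λ ps →
    ¬all λ { zero → p₀ ; (suc i) → ps i }

InPair : ∀ {a} {A : Set a} → A → A → A → Set a
InPair u v x = x ≡ u ⊎ x ≡ v

third-of-pair : ∀ {a} {A : Set a} {u v x y z : A} →
  InPair u v x → InPair u v y → InPair u v z → x ≢ y → z ≢ x → z ≡ y
third-of-pair (inj₁ x≡u) (inj₁ y≡u) _ x≢y _ = ⊥-elim (x≢y (trans x≡u (sym y≡u)))
third-of-pair (inj₂ x≡v) (inj₂ y≡v) _ x≢y _ = ⊥-elim (x≢y (trans x≡v (sym y≡v)))
third-of-pair (inj₁ x≡u) _ (inj₁ z≡u) _ z≢x = ⊥-elim (z≢x (trans z≡u (sym x≡u)))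
third-of-pair (inj₂ x≡v) _ (inj₂ z≡v) _ z≢x = ⊥-elim (z≢x (trans z≡v (sym x≡v)))
third-of-pair (inj₁ _) (inj₂ y≡v) (inj₂ z≡v) _ _ = trans z≡v (sym y≡v)
third-of-pair (inj₂ _) (inj₁ y≡u) (inj₁ z≡u) _ _ = trans z≡u (sym y≡u)

-- Adjacency in C_s and in its complement is decidable; on closed vertices
-- the decision computes, which supplies the many adjacencies of C_9^c.
succMod? : ∀ s (i j : Fin s) → Dec (SuccMod s i j)
succMod? s i j = (toℕ j ≟ suc (toℕ i)) ⊎-dec (toℕ i ≟ s ∸ 1 ×-dec toℕ j ≟ 0)

cycleComplAdj? : ∀ s (i j : Fin s) → Dec (CycleComplAdj s i j)
cycleComplAdj? s i j = ¬? (i Finₚ.≟ j) ×-dec ¬? (succMod? s i j ⊎-dec succMod? s j i)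

-- The initial segment {0,…,m-1} of C_n (m ≤ n) carries no cycle edge that
-- is not already an edge of C_m: the only difference is the closing edge.
succMod-restrict : ∀ {m n} (m≤n : m ≤ n) {i j : Fin m} →
  SuccMod n (inject≤ i m≤n) (inject≤ j m≤n) → SuccMod m i j
succMod-restrict m≤n {i} {j} (inj₁ j≡1+i) =
  inj₁ (trans (sym (Finₚ.toℕ-inject≤ j m≤n))
              (trans j≡1+i (cong suc (Finₚ.toℕ-inject≤ i m≤n))))
succMod-restrict {suc m} m≤n {i} {j} (inj₂ (i≡n-1 , j≡0)) =
  inj₂ (ℕₚ.≤-antisym (s≤s⁻¹ (Finₚ.toℕ<n i)) m≤i , trans (sym (Finₚ.toℕ-inject≤ j m≤n)) j≡0)
  where
  m≤i : m ≤ toℕ i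
  m≤i = subst (m ≤_) (trans (sym i≡n-1) (Finₚ.toℕ-inject≤ i m≤n)) (ℕₚ.∸-monoˡ-≤ 1 m≤n)

cycleComplAdj-restrict : ∀ {m n} (m≤n : m ≤ n) {i j : Fin m} →
  CycleComplAdj m i j → CycleComplAdj n (inject≤ i m≤n) (inject≤ j m≤n)
cycleComplAdj-restrict m≤n {i} {j} (i≢j , ¬adj) = distinct , nonadjacent
  where
  distinct : inject≤ i m≤n ≢ inject≤ j m≤n
  distinct = i≢j ∘ Finₚ.inject≤-injective m≤n m≤n i j
  nonadjacent : ¬ CycleAdj _ (inject≤ i m≤n) (inject≤ j m≤n)
  nonadjacent (inj₁ ij) = ¬adj (inj₁ (succMod-restrict m≤n ij))
  nonadjacent (inj₂ ji) = ¬adj (inj₂ (succMod-restrict m≤n ji))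

consecutive-inject≤ : ∀ {m n} (i : Fin m) (m<n : suc m ≤ n) →
  toℕ (inject≤ (suc i) m<n) ≡ suc (toℕ (inject≤ (inject₁ i) m<n))
consecutive-inject≤ i m<n = begin
  toℕ (inject≤ (suc i) m<n)            ≡⟨ Finₚ.toℕ-inject≤ (suc i) m<n ⟩
  suc (toℕ i)                          ≡⟨ cong suc (sym (Finₚ.toℕ-inject₁ i)) ⟩
  suc (toℕ (inject₁ i))                ≡⟨ cong suc (sym (Finₚ.toℕ-inject≤ (inject₁ i) m<n)) ⟩
  suc (toℕ (inject≤ (inject₁ i) m<n))  ∎
  where open ≡-Reasoning

module Boxes {a ℓ₁ ℓ₂ : Level} (O : TotalOrder a ℓ₁ ℓ₂) where
  open TotalOrder O using (module Eq)
    renaming (_≤_ to _⊑_; trans to ⊑-trans; refl to ⊑-refl; reflexive to ⊑-reflexive; total to ⊑-total)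

  record OverlapAt {d} (B C : Box O d) (k : Fin d) : Set ℓ₂ where
    constructor _,_
    field
      lower : lo B k ⊑ hi C k
      upper : lo C k ⊑ hi B k
  open OverlapAt

  Separated : ∀ {d} → Box O d → Box O d → Fin d → Set ℓ₂
  Separated B C k = ¬ OverlapAt B C k

  meets⇒overlap : ∀ {d} (B C : Box O d) → Meets O B C → ∀ k → OverlapAt B C k
  meets⇒overlap B C (x , x∈B , x∈C) k =
    ⊑-trans (proj₁ (x∈B k)) (proj₂ (x∈C k)) , ⊑-trans (proj₁ (x∈C k)) (proj₂ (x∈B k))

  -- Conversely, overlapping projections give a common point: in each
  -- coordinate take the larger of the two lower endpoints.
  overlap⇒meets : ∀ {d} (B C : Box O d) → (∀ k → OverlapAt B C k) → Meets O B C
  overlap⇒meets B C overlapping =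
    (λ k → proj₁ (common k)) , (λ k → proj₁ (proj₂ (common k))) , (λ k → proj₂ (proj₂ (common k)))
    where
    common : ∀ k → Σ _ λ x → (lo B k ⊑ x × x ⊑ hi B k) × (lo C k ⊑ x × x ⊑ hi C k)
    common k with ⊑-total (lo B k) (lo C k)
    ... | inj₁ B≤C = lo C k , (B≤C , upper (overlapping k)) , (⊑-refl , lo≤hi C k)
    ... | inj₂ C≤B = lo B k , (⊑-refl , lo≤hi B k) , (C≤B , lower (overlapping k))

  disjoint⇒separated : ∀ {d} {B C : Box O d} → ¬ Meets O B C → ¬ ¬ Σ (Fin d) (Separated B C)
  disjoint⇒separated {B = B} {C} disjoint ¬separated =
    ¬¬-shiftFin (λ k ¬overlap → ¬separated (k , ¬overlap)) (disjoint ∘ overlap⇒meets B C)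

  IsDirection : ∀ {d} (X : Box O d) → Is2Box O X → Fin d → Set
  IsDirection X (i , j , _) = InPair i j

  -- Fact (1): a 2-box meeting two boxes separated in coordinate k is
  -- nondegenerate in direction k, since a point projection would lie in
  -- both projections.
  separator-is-direction : ∀ {d} {X U W : Box O d} {k : Fin d} (X₂ : Is2Box O X) →
    Separated U W k → Meets O X U → Meets O X W → IsDirection X X₂ k
  separator-is-direction {X = X} {U} {W} {k} (i , j , _ , _ , _ , flat) separated X∩U X∩W
    with k Finₚ.≟ i | k Finₚ.≟ j
  ... | yes k≡i | _ = inj₁ k≡i
  ... | no _ | yes k≡j = inj₂ k≡j
  ... | no k≢i | no k≢j = ⊥-elim (separated (through U W XU XW , through W U XW XU))
    where
    XU = meets⇒overlap X U X∩U k
    XW = meets⇒overlap X W X∩W k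
    through : ∀ V V′ → OverlapAt X V k → OverlapAt X V′ k → lo V k ⊑ hi V′ k
    through V V′ XV XV′ =
      ⊑-trans (upper XV) (⊑-trans (⊑-reflexive (Eq.sym (flat k k≢i k≢j))) (lower XV′))

  -- If W and Z both overlap U and V in coordinate k, and U, V are
  -- separated there, then W lies below the top of Z: otherwise the gap
  -- above Z and below W would join U and V.
  bridged : ∀ {d} {U V W Z : Box O d} {k : Fin d} → Separated U V k →
    OverlapAt W U k → OverlapAt W V k → OverlapAt Z U k → OverlapAt Z V k →
    lo W k ⊑ hi Z k
  bridged {W = W} {Z} {k} separated WU WV ZU ZV
    with ⊑-total (lo W k) (hi Z k)
  ... | inj₁ W≤Z = W≤Z
  ... | inj₂ Z≤W = ⊥-elim (separated
        ( ⊑-trans (upper ZU) (⊑-trans Z≤W (lower WV))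
        , ⊑-trans (upper ZV) (⊑-trans Z≤W (lower WU))))

  no-common-separator : ∀ {d} {U V W Z : Box O d} {k : Fin d} →
    Separated U V k → Separated W Z k →
    Meets O W U → Meets O W V → Meets O Z U → Meets O Z V → ⊥
  no-common-separator {U = U} {V} {W} {Z} {k} UV WZ W∩U W∩V Z∩U Z∩V =
    WZ (bridged UV WU WV ZU ZV , bridged UV ZU ZV WU WV)
    where
    WU = meets⇒overlap W U W∩U k
    WV = meets⇒overlap W V W∩V k
    ZU = meets⇒overlap Z U Z∩U k
    ZV = meets⇒overlap Z V Z∩V k

  module NineBoxes {d} (Y : Fin 9 → Box O d) (two-box : ∀ x → Is2Box O (Y x))
    (meet : ∀ x y → CycleComplAdj 9 x y → Meets O (Y x) (Y y))
    (k : Fin 8 → Fin d) (cut : ∀ i → Separated (Y (inject₁ i)) (Y (suc i)) (k i)) where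

    meet! : ∀ x y → {True (cycleComplAdj? 9 x y)} → Meets O (Y x) (Y y)
    meet! x y {adj} = meet x y (toWitness adj)

    direction : ∀ x i → {True (cycleComplAdj? 9 x (inject₁ i))} →
      {True (cycleComplAdj? 9 x (suc i))} → IsDirection (Y x) (two-box x) (k i)
    direction x i {adj₁} {adj₂} =
      separator-is-direction {X = Y x} (two-box x) (cut i)
        (meet! x (inject₁ i) {adj₁}) (meet! x (suc i) {adj₂})

    apart : ∀ i j →
      {True (cycleComplAdj? 9 (inject₁ j) (inject₁ i))} → {True (cycleComplAdj? 9 (inject₁ j) (suc i))} →
      {True (cycleComplAdj? 9 (suc j) (inject₁ i))} → {True (cycleComplAdj? 9 (suc j) (suc i))} →
      k i ≢ k j
    apart i j {a₁} {a₂} {a₃} {a₄} ki≡kj =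
      no-common-separator (cut i) (subst (Separated (Y (inject₁ j)) (Y (suc j))) (sym ki≡kj) (cut j))
        (meet! (inject₁ j) (inject₁ i) {a₁}) (meet! (inject₁ j) (suc i) {a₂})
        (meet! (suc j) (inject₁ i) {a₃}) (meet! (suc j) (suc i) {a₄})

    -- Directions of Y 0 contain k 2,…,k 6, those of Y 1 contain k 3, k 6, k 7,
    -- those of Y 8 contain k 1, k 2, k 5; pigeonhole then forces k 1 ≡ k 5.
    separators-collide : ⊥
    separators-collide = apart (# 1) (# 5) k₁≡k₅
      where
      k₆≡k₅ : k (# 6) ≡ k (# 5)
      k₆≡k₅ = third-of-pair (direction (# 0) (# 2)) (direction (# 0) (# 5)) (direction (# 0) (# 6))
        (apart (# 2) (# 5)) (apart (# 2) (# 6) ∘ sym)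
      k₇≡k₆ : k (# 7) ≡ k (# 6)
      k₇≡k₆ = third-of-pair (direction (# 1) (# 3)) (direction (# 1) (# 6)) (direction (# 1) (# 7))
        (apart (# 3) (# 6)) (apart (# 3) (# 7) ∘ sym)
      k₄≡k₂ : k (# 4) ≡ k (# 2)
      k₄≡k₂ = third-of-pair (direction (# 0) (# 5)) (direction (# 0) (# 2)) (direction (# 0) (# 4))
        (apart (# 2) (# 5) ∘ sym) (λ k₄≡k₅ → apart (# 4) (# 7) (trans k₄≡k₅ (sym (trans k₇≡k₆ k₆≡k₅))))
      k₁≡k₅ : k (# 1) ≡ k (# 5)
      k₁≡k₅ = third-of-pair (direction (# 8) (# 2)) (direction (# 8) (# 5)) (direction (# 8) (# 1))
        (apart (# 2) (# 5)) (λ k₁≡k₂ → apart (# 1) (# 4) (trans k₁≡k₂ (sym k₄≡k₂)))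

  nine-boxes : ∀ {d} (Y : Fin 9 → Box O d) → (∀ x → Is2Box O (Y x)) →
    (∀ x y → CycleComplAdj 9 x y → Meets O (Y x) (Y y)) →
    (∀ (i : Fin 8) → ¬ Meets O (Y (inject₁ i)) (Y (suc i))) → ⊥
  nine-boxes Y two-box meet disjoint =
    ¬¬-shiftFin (λ i → disjoint⇒separated (disjoint i)) λ cuts →
      NineBoxes.separators-collide Y two-box meet (proj₁ ∘ cuts) (λ i → proj₂ (cuts i))

lemma3 : ∀ {a ℓ₁ ℓ₂ : Level} (O : TotalOrder a ℓ₁ ℓ₂) (s d : ℕ) → 9 ≤ s → 2 < d →
    ¬ (Σ (Fin s → Box O d) λ X →
         ((i : Fin s) → Is2Box O (X i)) × IsIntersectionGraphOf O (CycleComplAdj s) X)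
lemma3 O s d 9≤s _ (X , two-box , intersection) =
  nine-boxes (X ∘ embed) (two-box ∘ embed) meet disjoint
  where
  open Boxes O
  embed : Fin 9 → Fin s
  embed x = inject≤ x 9≤s
  meet : ∀ x y → CycleComplAdj 9 x y → Meets O (X (embed x)) (X (embed y))
  meet x y adj = Equivalence.to (intersection _ _ (proj₁ adj′)) adj′
    where adj′ = cycleComplAdj-restrict 9≤s adj
  disjoint : ∀ (i : Fin 8) → ¬ Meets O (X (embed (inject₁ i))) (X (embed (suc i)))
  disjoint i X∩X′ = proj₂ complement-edge (inj₁ (inj₁ consecutive))
    where
    consecutive : toℕ (embed (suc i)) ≡ suc (toℕ (embed (inject₁ i)))
    consecutive = consecutive-inject≤ i 9≤s
    distinct : embed (inject₁ i) ≢ embed (suc i)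
    distinct same = ℕₚ.1+n≢n (sym (trans (cong toℕ same) consecutive))
    complement-edge : CycleComplAdj s (embed (inject₁ i)) (embed (suc i))
    complement-edge = Equivalence.from (intersection (embed (inject₁ i)) (embed (suc i)) distinct) X∩X′
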